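{- Let $a,b,c$ be positive integers with $a\le b\le c$. Then the complete tripartite graph $K_{a,b,c}$ is a double approval interval graph if and only if $a=1$.
   Context: An approval interval is a triple $I(x)=(x_l,x_a,x_r)$ of reals with $x_l<x_a<x_r$. A double approval interval representation of a graph $G$ assigns to each vertex $x$ an approval interval $I(x)$ such that distinct vertices $x,y$ are adjacent if and only if $[x_l,x_r]$ and $[y_l,y_r]$ intersect and their intersection contains both approval marks $x_a$ and $y_a$. A graph is a double approval interval graph if it has such a representation.
   Formalization: The approval intervals have rational endpoints and rational approval marks instead of real ones. -}

module Defs where

open import Level using (0ℓ)
open import Data.Nat using (ℕ)
open import Data.Fin using (Fin)
open import Data.Sum using (_⊎_; inj₁; inj₂)
open import Data.Product using (_×_; Σ)
open import Data.Rational using (ℚ; _≤_; _<_)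
open import Relation.Binary.PropositionalEquality using (_≡_; _≢_)
open import Function.Bundles using (_⇔_)

record Graph : Set₁ where
  field
    V   : Set
    Adj : V → V → Set

open Graph public

-- An approval interval (x_l, x_a, x_r) with x_l < x_a < x_r.
-- Coordinates are rationals (the standard library has no reals).
record ApprovalInterval : Set where
  constructor mkAI
  field
    l a r : ℚ
    l<a   : l < a
    a<r   : a < r

open ApprovalInterval public

_∈I_ : ℚ → ApprovalInterval → Set
p ∈I x = (l x ≤ p) × (p ≤ r x)

Intersect : ApprovalInterval → ApprovalInterval → Set
Intersect x y = (l x ≤ r y) × (l y ≤ r x)

InIntersection : ℚ → ApprovalInterval → ApprovalInterval → Set
InIntersection p x y = (p ∈I x) × (p ∈I y)

DAAdj : ApprovalInterval → ApprovalInterval → Set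
DAAdj x y = Intersect x y × InIntersection (a x) x y × InIntersection (a y) x y

DARepresentation : Graph → Set
DARepresentation G =
  Σ (V G → ApprovalInterval) λ I →
    ∀ (x y : V G) → x ≢ y → (Adj G x y ⇔ DAAdj (I x) (I y))

IsDAIGraph : Graph → Set
IsDAIGraph G = DARepresentation G

part : {a b c : ℕ} → Fin a ⊎ (Fin b ⊎ Fin c) → Fin 3
part (inj₁ _)        = Data.Fin.zero
part (inj₂ (inj₁ _)) = Data.Fin.suc Data.Fin.zero
part (inj₂ (inj₂ _)) = Data.Fin.suc (Data.Fin.suc Data.Fin.zero)

K₃ : ℕ → ℕ → ℕ → Graph
K₃ a b c = record
  { V   = Fin a ⊎ (Fin b ⊎ Fin c)
  ; Adj = λ x y → part {a} {b} {c} x ≢ part {a} {b} {c} y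
  }

{-# OPTIONS --safe #-}
-- Two distinct vertices x, y of one part are non-adjacent, so some approval
-- point, say x_a, misses the other interval: x_a < y_l (a left gap) or
-- y_r < x_a (a right gap).  If every part has two vertices, two of the three
-- parts have gaps on the same side.  Two left gaps x_a < y_l and x'_a < y'_l
-- in different parts contradict completeness between the parts, which gives
-- y_l ≤ x'_a and y'_l ≤ x_a, hence x_a < y_l ≤ x'_a < y'_l ≤ x_a; right gaps
-- are symmetric.  For a = 1 the approval points are placed in the order
-- B₀ < ⋯ < B_{b-1} < A < C₀ < ⋯ < C_{c-1}: each B-interval starts just left
-- of its approval and runs to the far right, each C-interval starts at the
-- far left and ends just right of its approval, and A spans everything.

module Submission where

open import Defs
open import Data.Nat using (ℕ; _≤_)
open import Relation.Binary.PropositionalEquality using (_≡_)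
open import Function.Bundles using (_⇔_)

open import Data.Empty using (⊥; ⊥-elim)
open import Data.Fin as Fin using (Fin; zero; suc; toℕ; _↑ˡ_)
open import Data.Fin.Properties using (<-cmp; toℕ<n)
open import Data.Integer as ℤ using (+_; +≤+; +<+)
import Data.Integer.Properties as ℤ
open import Data.Nat as ℕ using (suc; z≤n; s≤s; z<s; _+_; _*_)
import Data.Nat.Properties as ℕ
open import Data.Nat.Coprimality using (1-coprimeTo) renaming (sym to coprime-sym)
open import Data.Product using (_×_; _,_; proj₁; proj₂; ∃₂; swap)
open import Data.Rational as ℚ using (ℚ; mkℚ; *≤*; *<*)
import Data.Rational.Properties as ℚ
open import Data.Sum as Sum using (_⊎_; inj₁; inj₂)
open import Function using (_∘_)
open import Function.Bundles using (mk⇔; Equivalence)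
open import Relation.Binary.Definitions using (tri<; tri≈; tri>)
open import Relation.Binary.PropositionalEquality using (refl; sym; trans; cong; subst₂; _≢_)
open import Relation.Nullary using (¬_; Dec; yes; no)
open import Relation.Nullary.Decidable using (_×-dec_)

_∈I?_ : ∀ p X → Dec (p ∈I X)
p ∈I? X = l X ℚ.≤? p ×-dec p ℚ.≤? r X

approval∈self : ∀ X → a X ∈I X
approval∈self X = ℚ.<⇒≤ (l<a X) , ℚ.<⇒≤ (a<r X)

∉I⇒outside : ∀ p X → ¬ (p ∈I X) → p ℚ.< l X ⊎ r X ℚ.< p
∉I⇒outside p X p∉X with l X ℚ.≤? p | p ℚ.≤? r X
... | no  l≰p | _       = inj₁ (ℚ.≰⇒> l≰p)
... | yes _   | no  p≰r = inj₂ (ℚ.≰⇒> p≰r)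
... | yes l≤p | yes p≤r = ⊥-elim (p∉X (l≤p , p≤r))

DAAdj-sym : ∀ X Y → DAAdj X Y → DAAdj Y X
DAAdj-sym _ _ (meet , aX∈ , aY∈) = swap meet , swap aY∈ , swap aX∈

approvalˡ∈ : ∀ X Y → DAAdj X Y → a X ∈I Y
approvalˡ∈ _ _ (_ , (_ , aX∈Y) , _) = aX∈Y

approvalʳ∈ : ∀ X Y → DAAdj X Y → a Y ∈I X
approvalʳ∈ _ _ (_ , _ , (aY∈X , _)) = aY∈X

approvals∈⇒DAAdj : ∀ X Y → a X ∈I Y → a Y ∈I X → DAAdj X Y
approvals∈⇒DAAdj X Y aX∈Y aY∈X =
  (ℚ.≤-trans (proj₁ aY∈X) (proj₂ (approval∈self Y)) ,
   ℚ.≤-trans (proj₁ aX∈Y) (proj₂ (approval∈self X))) ,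
  (approval∈self X , aX∈Y) ,
  (aY∈X , approval∈self Y)

¬DAAdj⇒approval∉ : ∀ X Y → ¬ DAAdj X Y → ¬ (a X ∈I Y) ⊎ ¬ (a Y ∈I X)
¬DAAdj⇒approval∉ X Y ¬adj with a X ∈I? Y
... | no  aX∉Y = inj₁ aX∉Y
... | yes aX∈Y = inj₂ (¬adj ∘ approvals∈⇒DAAdj X Y aX∈Y)

approval-left⇒¬DAAdj : ∀ X Y → a X ℚ.< l Y → ¬ DAAdj X Y
approval-left⇒¬DAAdj X Y aX<lY adj =
  ℚ.<-irrefl refl (ℚ.<-≤-trans aX<lY (proj₁ (approvalˡ∈ X Y adj)))

approval-right⇒¬DAAdj : ∀ X Y → r Y ℚ.< a X → ¬ DAAdj X Y
approval-right⇒¬DAAdj X Y rY<aX adj =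
  ℚ.<-irrefl refl (ℚ.<-≤-trans rY<aX (proj₂ (approvalˡ∈ X Y adj)))

<-ordered⇒¬DAAdj : ∀ {n} (J : Fin n → ApprovalInterval) →
                    (∀ {i k} → i Fin.< k → ¬ DAAdj (J i) (J k)) →
                    ∀ {i k} → i ≢ k → ¬ DAAdj (J i) (J k)
<-ordered⇒¬DAAdj J ordered {i} {k} i≢k with <-cmp i k
... | tri< i<k _   _   = ordered i<k
... | tri≈ _   i≡k _   = ⊥-elim (i≢k i≡k)
... | tri> _   _   k<i = ordered k<i ∘ DAAdj-sym (J i) (J k)

LeftGap RightGap : (Fin 2 → ApprovalInterval) → Set
LeftGap  P = ∃₂ λ s t → a (P s) ℚ.< l (P t)
RightGap P = ∃₂ λ s t → r (P t) ℚ.< a (P s)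

∉I⇒gap : ∀ P s t → ¬ (a (P s) ∈I P t) → LeftGap P ⊎ RightGap P
∉I⇒gap P s t aₛ∉Pₜ =
  Sum.map (λ lt → s , t , lt) (λ lt → s , t , lt) (∉I⇒outside (a (P s)) (P t) aₛ∉Pₜ)

¬DAAdj⇒gap : ∀ P → ¬ DAAdj (P zero) (P (suc zero)) → LeftGap P ⊎ RightGap P
¬DAAdj⇒gap P = Sum.[ ∉I⇒gap P zero (suc zero) , ∉I⇒gap P (suc zero) zero ]′
               ∘ ¬DAAdj⇒approval∉ (P zero) (P (suc zero))

leftGaps-clash : ∀ P Q → LeftGap P → LeftGap Q → (∀ s t → DAAdj (P s) (Q t)) → ⊥
leftGaps-clash P Q (s , t , aPs<lPt) (s′ , t′ , aQs′<lQt′) adj =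
  ℚ.<-irrefl refl (begin-strict
    a (P s)   <⟨ aPs<lPt ⟩
    l (P t)   ≤⟨ proj₁ (approvalʳ∈ (P t) (Q s′) (adj t s′)) ⟩
    a (Q s′)  <⟨ aQs′<lQt′ ⟩
    l (Q t′)  ≤⟨ proj₁ (approvalˡ∈ (P s) (Q t′) (adj s t′)) ⟩
    a (P s)   ∎)
  where open ℚ.≤-Reasoning

rightGaps-clash : ∀ P Q → RightGap P → RightGap Q → (∀ s t → DAAdj (P s) (Q t)) → ⊥
rightGaps-clash P Q (s , t , rPt<aPs) (s′ , t′ , rQt′<aQs′) adj =
  ℚ.<-irrefl refl (begin-strict
    a (P s)   ≤⟨ proj₂ (approvalˡ∈ (P s) (Q t′) (adj s t′)) ⟩
    r (Q t′)  <⟨ rQt′<aQs′ ⟩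
    a (Q s′)  ≤⟨ proj₂ (approvalʳ∈ (P t) (Q s′) (adj t s′)) ⟩
    r (P t)   <⟨ rPt<aPs ⟩
    a (P s)   ∎)
  where open ℚ.≤-Reasoning

no-K₂₂₂-realisation : (P : Fin 3 → Fin 2 → ApprovalInterval) →
                      (∀ p → ¬ DAAdj (P p zero) (P p (suc zero))) →
                      (∀ p q → p ≢ q → ∀ s t → DAAdj (P p s) (P q t)) → ⊥
no-K₂₂₂-realisation P nonadj adj = gaps-clash (gap _) (gap _) (gap _)
  where
    Gap : Fin 3 → Set
    Gap p = LeftGap (P p) ⊎ RightGap (P p)

    gap : ∀ p → Gap p
    gap p = ¬DAAdj⇒gap (P p) (nonadj p)

    clashˡ : ∀ {p q} → p ≢ q → LeftGap (P p) → LeftGap (P q) → ⊥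
    clashˡ {p} {q} p≢q gp gq = leftGaps-clash (P p) (P q) gp gq (adj p q p≢q)

    clashʳ : ∀ {p q} → p ≢ q → RightGap (P p) → RightGap (P q) → ⊥
    clashʳ {p} {q} p≢q gp gq = rightGaps-clash (P p) (P q) gp gq (adj p q p≢q)

    gaps-clash : Gap zero → Gap (suc zero) → Gap (suc (suc zero)) → ⊥
    gaps-clash (inj₁ g₀) (inj₁ g₁) _         = clashˡ (λ ()) g₀ g₁
    gaps-clash (inj₂ g₀) (inj₂ g₁) _         = clashʳ (λ ()) g₀ g₁
    gaps-clash (inj₁ g₀) (inj₂ _)  (inj₁ g₂) = clashˡ (λ ()) g₀ g₂
    gaps-clash (inj₂ g₀) (inj₁ _)  (inj₂ g₂) = clashʳ (λ ()) g₀ g₂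
    gaps-clash (inj₂ _)  (inj₁ g₁) (inj₁ g₂) = clashˡ (λ ()) g₁ g₂
    gaps-clash (inj₁ _)  (inj₂ g₁) (inj₂ g₂) = clashʳ (λ ()) g₁ g₂

¬isDAI-K₃-2+ : ∀ a b c → ¬ IsDAIGraph (K₃ (2 + a) (2 + b) (2 + c))
¬isDAI-K₃-2+ a b c (I , represents) =
  no-K₂₂₂-realisation (λ p s → I (pick p s)) nonadjacent adjacent
  where
    pick : Fin 3 → Fin 2 → V (K₃ (2 + a) (2 + b) (2 + c))
    pick zero                s = inj₁ (s ↑ˡ a)
    pick (suc zero)          s = inj₂ (inj₁ (s ↑ˡ b))
    pick (suc (suc zero))    s = inj₂ (inj₂ (s ↑ˡ c))

    part-pick : ∀ p s → part (pick p s) ≡ p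
    part-pick zero             _ = refl
    part-pick (suc zero)       _ = refl
    part-pick (suc (suc zero)) _ = refl

    pick-distinct : ∀ p → pick p zero ≢ pick p (suc zero)
    pick-distinct zero             ()
    pick-distinct (suc zero)       ()
    pick-distinct (suc (suc zero)) ()

    nonadjacent : ∀ p → ¬ DAAdj (I (pick p zero)) (I (pick p (suc zero)))
    nonadjacent p adj =
      Equivalence.from (represents _ _ (pick-distinct p)) adj
        (trans (part-pick p zero) (sym (part-pick p (suc zero))))

    adjacent : ∀ p q → p ≢ q → ∀ s t → DAAdj (I (pick p s)) (I (pick q t))
    adjacent p q p≢q s t = Equivalence.to (represents _ _ (parts-differ ∘ cong part)) parts-differ
      where
        parts-differ : part (pick p s) ≢ part (pick q t)
        parts-differ = subst₂ _≢_ (sym (part-pick p s)) (sym (part-pick q t)) p≢q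

ι : ℕ → ℚ
ι n = mkℚ (+ n) 0 (coprime-sym (1-coprimeTo n))

ι-mono-≤ : ∀ {m n} → m ≤ n → ι m ℚ.≤ ι n
ι-mono-≤ {m} {n} m≤n =
  *≤* (subst₂ ℤ._≤_ (sym (ℤ.*-identityʳ (+ m))) (sym (ℤ.*-identityʳ (+ n))) (+≤+ m≤n))

ι-mono-< : ∀ {m n} → m ℕ.< n → ι m ℚ.< ι n
ι-mono-< {m} {n} m<n =
  *<* (subst₂ ℤ._<_ (sym (ℤ.*-identityʳ (+ m))) (sym (ℤ.*-identityʳ (+ n))) (+<+ m<n))

ι-between : ∀ {lo n hi} → lo ≤ n → n ≤ hi → ι lo ℚ.≤ ι n × ι n ℚ.≤ ι hi
ι-between lo≤n n≤hi = ι-mono-≤ lo≤n , ι-mono-≤ n≤hi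

ℕ-interval : ∀ lo ap hi → lo ℕ.< ap → ap ℕ.< hi → ApprovalInterval
ℕ-interval lo ap hi lo<ap ap<hi = mkAI (ι lo) (ι ap) (ι hi) (ι-mono-< lo<ap) (ι-mono-< ap<hi)

-- Slot m holds the points pos 1 m < pos 2 m: B i uses slot i, A slot b and
-- C j slot b + j.  As pos (2 + k) m reduces to pos k (suc m), an interval
-- ending at pos 3 m stops before the approval of slot suc m, and one
-- starting at pos 1 (suc m) starts after the approval of slot m.
pos : ℕ → ℕ → ℕ
pos k m = k + m * 2

pos-mono : ∀ k d {m n} → m ≤ n → pos k m ≤ pos (d + k) n
pos-mono k d m≤n = ℕ.+-mono-≤ (ℕ.m≤n+m k d) (ℕ.*-monoˡ-≤ 2 m≤n)

module Layout (b c : ℕ) where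

  top : ℕ
  top = b + c

  B-slot≤b : (i : Fin b) → toℕ i ≤ b
  B-slot≤b i = ℕ.<⇒≤ (toℕ<n i)

  C-slot≤top : (j : Fin c) → b + toℕ j ≤ top
  C-slot≤top j = ℕ.+-monoʳ-≤ b (ℕ.<⇒≤ (toℕ<n j))

  B-slot≤top : (i : Fin b) → toℕ i ≤ top
  B-slot≤top i = ℕ.≤-trans (B-slot≤b i) (ℕ.m≤m+n b c)

  B-slot≤C-slot : (i : Fin b) (j : Fin c) → toℕ i ≤ b + toℕ j
  B-slot≤C-slot i j = ℕ.≤-trans (B-slot≤b i) (ℕ.m≤m+n b (toℕ j))

  A : ApprovalInterval
  A = ℕ-interval 0 (pos 1 b) (pos 3 top) z<s (pos-mono 2 1 (ℕ.m≤m+n b c))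

  B : Fin b → ApprovalInterval
  B i = ℕ-interval (pos 1 (toℕ i)) (pos 2 (toℕ i)) (pos 3 top)
          ℕ.≤-refl (pos-mono 3 0 (B-slot≤top i))

  C : Fin c → ApprovalInterval
  C j = ℕ-interval 0 (pos 2 (b + toℕ j)) (pos 3 (b + toℕ j)) z<s ℕ.≤-refl

  A~B : ∀ i → DAAdj A (B i)
  A~B i = approvals∈⇒DAAdj A (B i)
    (ι-between (pos-mono 1 0 (B-slot≤b i)) (pos-mono 1 2 (ℕ.m≤m+n b c)))
    (ι-between z≤n (pos-mono 2 1 (B-slot≤top i)))

  A~C : ∀ j → DAAdj A (C j)
  A~C j = approvals∈⇒DAAdj A (C j)
    (ι-between z≤n (pos-mono 1 2 (ℕ.m≤m+n b (toℕ j))))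
    (ι-between z≤n (pos-mono 2 1 (C-slot≤top j)))

  B~C : ∀ i j → DAAdj (B i) (C j)
  B~C i j = approvals∈⇒DAAdj (B i) (C j)
    (ι-between z≤n (pos-mono 2 1 (B-slot≤C-slot i j)))
    (ι-between (pos-mono 1 1 (B-slot≤C-slot i j)) (pos-mono 2 1 (C-slot≤top j)))

  B-ordered : ∀ {i k} → i Fin.< k → ¬ DAAdj (B i) (B k)
  B-ordered {i} {k} i<k = approval-left⇒¬DAAdj (B i) (B k) (ι-mono-< (pos-mono 1 0 i<k))

  C-ordered : ∀ {j k} → j Fin.< k → ¬ DAAdj (C j) (C k)
  C-ordered {j} {k} j<k =
    approval-right⇒¬DAAdj (C k) (C j) (ι-mono-< (pos-mono 2 0 (ℕ.+-monoʳ-< b j<k)))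
    ∘ DAAdj-sym (C j) (C k)

  I : V (K₃ 1 b c) → ApprovalInterval
  I (inj₁ _)         = A
  I (inj₂ (inj₁ i))  = B i
  I (inj₂ (inj₂ j))  = C j

  adjacent : ∀ x y → part x ≢ part y → DAAdj (I x) (I y)
  adjacent (inj₁ _)        (inj₁ _)        p≢p = ⊥-elim (p≢p refl)
  adjacent (inj₂ (inj₁ _)) (inj₂ (inj₁ _)) p≢p = ⊥-elim (p≢p refl)
  adjacent (inj₂ (inj₂ _)) (inj₂ (inj₂ _)) p≢p = ⊥-elim (p≢p refl)
  adjacent (inj₁ _)        (inj₂ (inj₁ i)) _   = A~B i
  adjacent (inj₁ _)        (inj₂ (inj₂ j)) _   = A~C j
  adjacent (inj₂ (inj₁ i)) (inj₂ (inj₂ j)) _   = B~C i j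
  adjacent (inj₂ (inj₁ i)) (inj₁ _)        _   = DAAdj-sym A (B i) (A~B i)
  adjacent (inj₂ (inj₂ j)) (inj₁ _)        _   = DAAdj-sym A (C j) (A~C j)
  adjacent (inj₂ (inj₂ j)) (inj₂ (inj₁ i)) _   = DAAdj-sym (B i) (C j) (B~C i j)

  nonadjacent : ∀ x y → x ≢ y → part x ≡ part y → ¬ DAAdj (I x) (I y)
  nonadjacent (inj₁ zero)     (inj₁ zero)     x≢y _ = ⊥-elim (x≢y refl)
  nonadjacent (inj₂ (inj₁ _)) (inj₂ (inj₁ _)) x≢y _ =
    <-ordered⇒¬DAAdj B B-ordered (x≢y ∘ cong (inj₂ ∘ inj₁))
  nonadjacent (inj₂ (inj₂ _)) (inj₂ (inj₂ _)) x≢y _ =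
    <-ordered⇒¬DAAdj C C-ordered (x≢y ∘ cong (inj₂ ∘ inj₂))
  nonadjacent (inj₁ _)        (inj₂ (inj₁ _)) _ ()
  nonadjacent (inj₁ _)        (inj₂ (inj₂ _)) _ ()
  nonadjacent (inj₂ (inj₁ _)) (inj₁ _)        _ ()
  nonadjacent (inj₂ (inj₁ _)) (inj₂ (inj₂ _)) _ ()
  nonadjacent (inj₂ (inj₂ _)) (inj₁ _)        _ ()
  nonadjacent (inj₂ (inj₂ _)) (inj₂ (inj₁ _)) _ ()

isDAI-K₃-1 : ∀ b c → IsDAIGraph (K₃ 1 b c)
isDAI-K₃-1 b c = I , λ x y x≢y → mk⇔ (adjacent x y) (λ adj same → nonadjacent x y x≢y same adj)
  where open Layout b c

corollary27 : (a b c : ℕ) → 1 ≤ a → a ≤ b → b ≤ c →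
    (IsDAIGraph (K₃ a b c) ⇔ a ≡ 1)
corollary27 1 b c _ _ _ = mk⇔ (λ _ → refl) (λ _ → isDAI-K₃-1 b c)
corollary27 (suc (suc a)) (suc (suc b)) (suc (suc c)) _ (s≤s (s≤s _)) (s≤s (s≤s _)) =
  mk⇔ (⊥-elim ∘ ¬isDAI-K₃-2+ a b c) λ ()
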